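{- For each integer $n\ge0$, \[T(2,n;0)<T(2,n;1)<\dots<T(2,n;\lceil n/2\rceil)\] and \[T(2,n;\lceil n/2\rceil)>T(2,n;\lceil n/2\rceil+1)>\dots>T(2,n;n).\]
   Context: For integers $n\ge0$ and $k\ge0$, $T(2,n;k)$ denotes the number of ways to select a set of $k$ squares from a $2\times n$ rectangular grid of unit squares ($2$ rows, $n$ columns) such that no two selected squares are horizontally or vertically adjacent (share an edge); $T(2,0;0)=1$. -}

module Defs where

open import Data.Nat using (ℕ; zero; suc; _+_)
open import Data.Bool using (Bool; true; false; _∧_; _∨_; not; if_then_else_)
open import Data.Product using (_×_; _,_)
open import Data.List using (List; []; _∷_; concatMap; length; filter)
open import Data.Vec using (Vec; []; _∷_)
open import Data.Nat using (_≡ᵇ_)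
import Data.Bool as B

-- A selection of squares of the 2 × n grid: for each column, a pair
-- (is the top square selected?, is the bottom square selected?).
Selection : ℕ → Set
Selection n = Vec (Bool × Bool) n

allSelections : (n : ℕ) → List (Selection n)
allSelections zero = [] ∷ []
allSelections (suc n) =
  concatMap (λ v → ((false , false) ∷ v) ∷ ((true , false) ∷ v) ∷ ((false , true) ∷ v) ∷ ((true , true) ∷ v) ∷ [])
            (allSelections n)

count : ∀ {n} → Selection n → ℕ
count [] = 0
count ((a , b) ∷ v) = (if a then 1 else 0) + (if b then 1 else 0) + count v

-- No two selected squares share an edge: within a column (vertical
-- adjacency) the two squares are not both selected, and in consecutive
-- columns (horizontal adjacency) the same row is not selected twice.
independent : ∀ {n} → Selection n → Bool
independent [] = true
independent ((a , b) ∷ []) = not (a ∧ b)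
independent ((a , b) ∷ (c , d) ∷ v) =
  not (a ∧ b) ∧ not (a ∧ c) ∧ not (b ∧ d) ∧ independent ((c , d) ∷ v)

T2 : ℕ → ℕ → ℕ
T2 n k = length (filter (λ v → (independent v ∧ (count v ≡ᵇ k)) B.≟ true) (allSelections n))

-- Reading the grid column by column, an admissible selection is a word over
-- the columns empty, top, bottom (the full column is forbidden) in which no
-- row is selected in two consecutive columns.  Counting such words gives a
-- transfer system of two sequences: free n k (no constraint on the first
-- column, this is T(2,n;k)) and capped n k (one prescribed square of the
-- first column is forbidden).  Along an antidiagonal these are Delannoy
-- numbers D(a,b) (lattice paths with steps (1,0), (0,1), (1,1)):
--   capped (a + b) a = D(a,b),   T(2,a+b;a) = D(a,b) + D(a-1,b).
-- The theorem thereby reduces to a monotonicity property of Delannoy numbers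
-- along antidiagonals: D(a,b+1) < D(a+1,b) whenever a < b.
module Submission where

open import Defs
open import Data.Nat using (ℕ; suc; _<_; _≤_; ⌈_/2⌉)
open import Data.Product using (_×_)

open import Data.Nat using (zero; _+_; _≡ᵇ_; z≤n; s≤s)
open import Data.Nat.Properties
open import Data.Nat.Solver using (module +-*-Solver)
open import Data.Bool using (Bool; true; false; _∧_; if_then_else_)
open import Data.Bool.Properties using (∧-zeroʳ)
import Data.Bool as B
open import Data.Product using (_,_; proj₁; proj₂)
open import Data.Sum using (inj₁; inj₂)
open import Data.List using (List; []; _∷_; concatMap; length; filter)
open import Data.Vec using ([]; _∷_)
open import Relation.Binary.PropositionalEquality
open +-*-Solver using (solve; _:=_; _:+_)

countWhere : {A : Set} → (A → Bool) → List A → ℕ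
countWhere h [] = 0
countWhere h (x ∷ xs) = (if h x then 1 else 0) + countWhere h xs

length-filter : {A : Set} (h : A → Bool) (xs : List A) →
  length (filter (λ v → h v B.≟ true) xs) ≡ countWhere h xs
length-filter h [] = refl
length-filter h (x ∷ xs) with h x
... | true = cong suc (length-filter h xs)
... | false = length-filter h xs

countWhere-cong : {A : Set} {h h′ : A → Bool} → (∀ x → h x ≡ h′ x) →
  (xs : List A) → countWhere h xs ≡ countWhere h′ xs
countWhere-cong eq [] = refl
countWhere-cong eq (x ∷ xs) = cong₂ _+_ (cong (λ b → if b then 1 else 0) (eq x)) (countWhere-cong eq xs)

countWhere-none : {A : Set} {h : A → Bool} → (∀ x → h x ≡ false) →
  (xs : List A) → countWhere h xs ≡ 0
countWhere-none none [] = refl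
countWhere-none none (x ∷ xs) rewrite none x = countWhere-none none xs

countWhere-concatMap₄ : {A C : Set} (h : C → Bool) (a b c d : A → C) (xs : List A) →
  countWhere h (concatMap (λ x → a x ∷ b x ∷ c x ∷ d x ∷ []) xs)
  ≡ countWhere (λ x → h (a x)) xs + countWhere (λ x → h (b x)) xs
    + countWhere (λ x → h (c x)) xs + countWhere (λ x → h (d x)) xs
countWhere-concatMap₄ h a b c d [] = refl
countWhere-concatMap₄ h a b c d (x ∷ xs) rewrite countWhere-concatMap₄ h a b c d xs =
  regroup (indicator (h (a x))) (indicator (h (b x))) (indicator (h (c x))) (indicator (h (d x))) _ _ _ _
  where
  indicator : Bool → ℕ
  indicator t = if t then 1 else 0
  regroup : ∀ p q r s P Q R S →
    p + (q + (r + (s + (P + Q + R + S)))) ≡ p + P + (q + Q) + (r + R) + (s + S)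
  regroup = solve 8 (λ p q r s P Q R S →
    p :+ (q :+ (r :+ (s :+ (P :+ Q :+ R :+ S)))) := p :+ P :+ (q :+ Q) :+ (r :+ R) :+ (s :+ S)) refl

cong-sum₄ : {a b c d a′ b′ c′ d′ : ℕ} → a ≡ a′ → b ≡ b′ → c ≡ c′ → d ≡ d′ →
  a + b + c + d ≡ a′ + b′ + c′ + d′
cong-sum₄ refl refl refl refl = refl

empty top bottom full : Bool × Bool
empty = false , false
top = true , false
bottom = false , true
full = true , true

extensions : Bool × Bool → ℕ → ℕ → ℕ
extensions p n k = countWhere (λ v → independent (p ∷ v) ∧ (count v ≡ᵇ k)) (allSelections n)

extensions-step : (p : Bool × Bool) (n k : ℕ) → extensions p (suc n) k
  ≡ countWhere (λ v → independent (p ∷ empty ∷ v) ∧ (count (empty ∷ v) ≡ᵇ k)) (allSelections n)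
    + countWhere (λ v → independent (p ∷ top ∷ v) ∧ (count (top ∷ v) ≡ᵇ k)) (allSelections n)
    + countWhere (λ v → independent (p ∷ bottom ∷ v) ∧ (count (bottom ∷ v) ≡ᵇ k)) (allSelections n)
    + countWhere (λ v → independent (p ∷ full ∷ v) ∧ (count (full ∷ v) ≡ᵇ k)) (allSelections n)
extensions-step p n k =
  countWhere-concatMap₄ _ (empty ∷_) (top ∷_) (bottom ∷_) (full ∷_) (allSelections n)

full-inadmissible : ∀ {n} (v : Selection n) → independent (full ∷ v) ≡ false
full-inadmissible [] = refl
full-inadmissible (x ∷ v) = refl

full-column-vanishes : ∀ n k → countWhere (λ v → independent (empty ∷ full ∷ v) ∧ (count (full ∷ v) ≡ᵇ k)) (allSelections n) ≡ 0
full-column-vanishes n k =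
  countWhere-none (λ v → cong (_∧ (count (full ∷ v) ≡ᵇ k)) (full-inadmissible v)) (allSelections n)

empty-unconstrained : ∀ {n} (v : Selection n) → independent (empty ∷ v) ≡ independent v
empty-unconstrained [] = refl
empty-unconstrained (x ∷ v) = refl

-- The counting model: free n k is T(2,n;k); capped n k counts the
-- k-selections of 2 × n whose first column avoids one prescribed square.
free capped : ℕ → ℕ → ℕ
free zero zero = 1
free zero (suc k) = 0
free (suc n) zero = free n zero
free (suc n) (suc k) = free n (suc k) + capped n k + capped n k
capped zero zero = 1
capped zero (suc k) = 0
capped (suc n) zero = free n zero
capped (suc n) (suc k) = free n (suc k) + capped n k

-- In each case the
-- first column is empty, top or bottom (contributing 0 or 1 square), while
-- full columns, columns clashing with p, and nonempty columns when k = 0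
-- contribute nothing.
extensions-empty : ∀ n k → extensions empty n k ≡ free n k
extensions-top : ∀ n k → extensions top n k ≡ capped n k
extensions-bottom : ∀ n k → extensions bottom n k ≡ capped n k

extensions-empty zero zero = refl
extensions-empty zero (suc k) = refl
extensions-empty (suc n) zero = begin
    extensions empty (suc n) zero
  ≡⟨ extensions-step empty n zero ⟩
    _
  ≡⟨ cong-sum₄ (extensions-empty n zero)
       (countWhere-none (λ v → ∧-zeroʳ _) (allSelections n))
       (countWhere-none (λ v → ∧-zeroʳ _) (allSelections n))
       (full-column-vanishes n zero) ⟩
    free n zero + 0 + 0 + 0
  ≡⟨ trans (+-identityʳ _) (trans (+-identityʳ _) (+-identityʳ _)) ⟩
    free (suc n) zero ∎
  where open ≡-Reasoning
extensions-empty (suc n) (suc k) = begin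
    extensions empty (suc n) (suc k)
  ≡⟨ extensions-step empty n (suc k) ⟩
    _
  ≡⟨ cong-sum₄ (extensions-empty n (suc k)) (extensions-top n k) (extensions-bottom n k)
       (full-column-vanishes n (suc k)) ⟩
    free n (suc k) + capped n k + capped n k + 0
  ≡⟨ +-identityʳ _ ⟩
    free (suc n) (suc k) ∎
  where open ≡-Reasoning

extensions-top zero zero = refl
extensions-top zero (suc k) = refl
extensions-top (suc n) zero = begin
    extensions top (suc n) zero
  ≡⟨ extensions-step top n zero ⟩
    _
  ≡⟨ cong-sum₄ (extensions-empty n zero)
       (countWhere-none (λ v → refl) (allSelections n))
       (countWhere-none (λ v → ∧-zeroʳ _) (allSelections n))
       (countWhere-none (λ v → refl) (allSelections n)) ⟩
    free n zero + 0 + 0 + 0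
  ≡⟨ trans (+-identityʳ _) (trans (+-identityʳ _) (+-identityʳ _)) ⟩
    capped (suc n) zero ∎
  where open ≡-Reasoning
extensions-top (suc n) (suc k) = begin
    extensions top (suc n) (suc k)
  ≡⟨ extensions-step top n (suc k) ⟩
    _
  ≡⟨ cong-sum₄ (extensions-empty n (suc k))
       (countWhere-none (λ v → refl) (allSelections n))
       (extensions-bottom n k)
       (countWhere-none (λ v → refl) (allSelections n)) ⟩
    free n (suc k) + 0 + capped n k + 0
  ≡⟨ trans (+-identityʳ _) (cong (_+ capped n k) (+-identityʳ _)) ⟩
    capped (suc n) (suc k) ∎
  where open ≡-Reasoning

extensions-bottom zero zero = refl
extensions-bottom zero (suc k) = refl
extensions-bottom (suc n) zero = begin
    extensions bottom (suc n) zero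
  ≡⟨ extensions-step bottom n zero ⟩
    _
  ≡⟨ cong-sum₄ (extensions-empty n zero)
       (countWhere-none (λ v → ∧-zeroʳ _) (allSelections n))
       (countWhere-none (λ v → refl) (allSelections n))
       (countWhere-none (λ v → refl) (allSelections n)) ⟩
    free n zero + 0 + 0 + 0
  ≡⟨ trans (+-identityʳ _) (trans (+-identityʳ _) (+-identityʳ _)) ⟩
    capped (suc n) zero ∎
  where open ≡-Reasoning
extensions-bottom (suc n) (suc k) = begin
    extensions bottom (suc n) (suc k)
  ≡⟨ extensions-step bottom n (suc k) ⟩
    _
  ≡⟨ cong-sum₄ (extensions-empty n (suc k))
       (extensions-top n k)
       (countWhere-none (λ v → refl) (allSelections n))
       (countWhere-none (λ v → refl) (allSelections n)) ⟩
    free n (suc k) + capped n k + 0 + 0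
  ≡⟨ trans (+-identityʳ _) (+-identityʳ _) ⟩
    capped (suc n) (suc k) ∎
  where open ≡-Reasoning

T2≡free : ∀ n k → T2 n k ≡ free n k
T2≡free n k = begin
    T2 n k
  ≡⟨ length-filter (λ v → independent v ∧ (count v ≡ᵇ k)) (allSelections n) ⟩
    countWhere (λ v → independent v ∧ (count v ≡ᵇ k)) (allSelections n)
  ≡⟨ countWhere-cong (λ v → cong (_∧ (count v ≡ᵇ k)) (sym (empty-unconstrained v))) (allSelections n) ⟩
    extensions empty n k
  ≡⟨ extensions-empty n k ⟩
    free n k ∎
  where open ≡-Reasoning

delannoy : ℕ → ℕ → ℕ
delannoy zero b = 1
delannoy (suc a) zero = 1
delannoy (suc a) (suc b) = delannoy a (suc b) + delannoy (suc a) b + delannoy a b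

delannoy-zeroʳ : ∀ a → delannoy a 0 ≡ 1
delannoy-zeroʳ zero = refl
delannoy-zeroʳ (suc a) = refl

delannoy-sym : ∀ a b → delannoy a b ≡ delannoy b a
delannoy-sym zero zero = refl
delannoy-sym zero (suc b) = refl
delannoy-sym (suc a) zero = refl
delannoy-sym (suc a) (suc b)
  rewrite delannoy-sym a (suc b) | delannoy-sym (suc a) b | delannoy-sym a b =
  cong (_+ delannoy b a) (+-comm (delannoy (suc b) a) (delannoy b (suc a)))

delannoy-pos : ∀ a b → 1 ≤ delannoy a b
delannoy-pos zero b = s≤s z≤n
delannoy-pos (suc a) zero = s≤s z≤n
delannoy-pos (suc a) (suc b) = ≤-trans (delannoy-pos a b) (m≤n+m (delannoy a b) _)

-- T(2,a+b;a) in Delannoy form: D(a,b) + D(a-1,b).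
delannoySum : ℕ → ℕ → ℕ
delannoySum zero b = 1
delannoySum (suc a) b = delannoy (suc a) b + delannoy a b

free-zeroʳ : ∀ n → free n 0 ≡ 1
free-zeroʳ zero = refl
free-zeroʳ (suc n) = free-zeroʳ n

capped-zeroʳ : ∀ n → capped n 0 ≡ 1
capped-zeroʳ zero = refl
capped-zeroʳ (suc n) = free-zeroʳ n

too-many-squares : ∀ n k → n < k → free n k ≡ 0 × capped n k ≡ 0
too-many-squares zero (suc k) n<k = refl , refl
too-many-squares (suc n) (suc k) (s≤s n<k)
  rewrite proj₁ (too-many-squares n (suc k) (m<n⇒m<1+n n<k))
        | proj₂ (too-many-squares n k n<k) = refl , refl

-- On an antidiagonal the capped counts satisfy the Delannoy recurrence.
capped≡delannoy : ∀ a b → capped (a + b) a ≡ delannoy a b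
capped≡delannoy zero b = capped-zeroʳ b
capped≡delannoy (suc a) zero
  rewrite capped≡delannoy a zero | delannoy-zeroʳ a
        | proj₁ (too-many-squares (a + 0) (suc a) (s≤s (≤-reflexive (+-identityʳ a)))) = refl
capped≡delannoy (suc a) (suc b) = begin
    free (a + suc b) (suc a) + capped (a + suc b) a
  ≡⟨ cong₂ _+_ (cong (λ m → free m (suc a)) (+-suc a b)) (capped≡delannoy a (suc b)) ⟩
    free (suc (a + b)) (suc a) + delannoy a (suc b)
  ≡⟨ cong (_+ delannoy a (suc b)) (cong₂ _+_ (capped≡delannoy (suc a) b) (capped≡delannoy a b)) ⟩
    delannoy (suc a) b + delannoy a b + delannoy a (suc b)
  ≡⟨ solve 3 (λ x y z → x :+ y :+ z := z :+ x :+ y) refl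
       (delannoy (suc a) b) (delannoy a b) (delannoy a (suc b)) ⟩
    delannoy (suc a) (suc b) ∎
  where open ≡-Reasoning

-- Consequently T(2,a+b;a) = D(a,b) + D(a-1,b), as free unfolds into two capped counts.
free≡delannoySum : ∀ a b → free (a + b) a ≡ delannoySum a b
free≡delannoySum zero b = free-zeroʳ b
free≡delannoySum (suc a) b = cong₂ _+_ (capped≡delannoy (suc a) b) (capped≡delannoy a b)

T2-adjacent : ∀ k c →
  T2 (suc k + c) k ≡ delannoySum k (suc c) × T2 (suc k + c) (suc k) ≡ delannoySum (suc k) c
T2-adjacent k c =
  trans (T2≡free (suc k + c) k)
        (trans (cong (λ m → free m k) (sym (+-suc k c))) (free≡delannoySum k (suc c)))
  , trans (T2≡free (suc k + c) (suc k)) (free≡delannoySum (suc k) c)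

-- Delannoy numbers increase towards the centre of an antidiagonal: moving
-- one step inwards from (a,b+1) to (a+1,b) strictly increases D when a < b
-- (and weakly when a ≤ b, the equality case being symmetry).
delannoy-step-< : ∀ a b → a < b → delannoy a (suc b) < delannoy (suc a) b
delannoy-step-≤ : ∀ a b → a ≤ b → delannoy a (suc b) ≤ delannoy (suc a) b
delannoy-step-< zero (suc b) 0<b =
  s≤s (≤-trans (delannoy-pos 1 b) (m≤m+n (delannoy 1 b) (delannoy 0 b)))
delannoy-step-< (suc a) (suc b) (s≤s a<b) =
  +-mono-< (+-mono-<-≤ (delannoy-step-< a (suc b) (m<n⇒m<1+n a<b)) (delannoy-step-≤ (suc a) b a<b))
           (delannoy-step-< a b a<b)
delannoy-step-≤ a b a≤b with m≤n⇒m<n∨m≡n a≤b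
... | inj₁ a<b = <⇒≤ (delannoy-step-< a b a<b)
... | inj₂ refl = ≤-reflexive (delannoy-sym a (suc a))

delannoySum-rising : ∀ k c → k ≤ c → delannoySum k (suc c) < delannoySum (suc k) c
delannoySum-rising zero c k≤c = +-mono-≤ (delannoy-pos 1 c) (delannoy-pos 0 c)
delannoySum-rising (suc k) c k<c =
  +-mono-≤-< (delannoy-step-≤ (suc k) c k<c) (delannoy-step-< k c k<c)

delannoySum-falling : ∀ k c → c < k → delannoySum (suc k) c < delannoySum k (suc c)
delannoySum-falling (suc k) c (s≤s c≤k) = +-mono-<-≤ outer inner
  where
  outer : delannoy (suc (suc k)) c < delannoy (suc k) (suc c)
  outer rewrite delannoy-sym (suc (suc k)) c | delannoy-sym (suc k) (suc c) =
    delannoy-step-< c (suc k) (s≤s c≤k)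
  inner : delannoy (suc k) c ≤ delannoy k (suc c)
  inner rewrite delannoy-sym (suc k) c | delannoy-sym k (suc c) = delannoy-step-≤ c k c≤k

rising-range : ∀ k c → suc k ≤ ⌈ suc k + c /2⌉ → k ≤ c
rising-range k c below = ≮⇒≥ λ c<k →
  1+n≰n (≤-trans below (≤-trans (⌈n/2⌉-mono (bound c<k)) (≤-reflexive (sym (n≡⌈n+n/2⌉ k)))))
  where
  bound : c < k → suc k + c ≤ k + k
  bound c<k = ≤-trans (≤-reflexive (sym (+-suc k c))) (+-monoʳ-≤ k c<k)

falling-range : ∀ k c → ⌈ suc k + c /2⌉ ≤ k → c < k
falling-range k c above = ≰⇒> λ k≤c →
  1+n≰n (≤-trans (≤-trans (≤-reflexive (cong suc (n≡⌊n+n/2⌋ k))) (⌈n/2⌉-mono (+-monoʳ-≤ (suc k) k≤c))) above)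

proposition5 : (n : ℕ) →
    ((k : ℕ) → suc k ≤ ⌈ n /2⌉ → T2 n k < T2 n (suc k))
    × ((k : ℕ) → ⌈ n /2⌉ ≤ k → suc k ≤ n → T2 n (suc k) < T2 n k)
proposition5 n = rising , falling
  where
  rising : (k : ℕ) → suc k ≤ ⌈ n /2⌉ → T2 n k < T2 n (suc k)
  rising k below with m≤n⇒∃[o]m+o≡n (≤-trans below (⌈n/2⌉≤n n))
  ... | c , refl with T2-adjacent k c
  ...   | lower , upper =
    subst₂ _<_ (sym lower) (sym upper) (delannoySum-rising k c (rising-range k c below))
  falling : (k : ℕ) → ⌈ n /2⌉ ≤ k → suc k ≤ n → T2 n (suc k) < T2 n k
  falling k above k<n with m≤n⇒∃[o]m+o≡n k<n
  ... | c , refl with T2-adjacent k c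
  ...   | lower , upper =
    subst₂ _<_ (sym upper) (sym lower) (delannoySum-falling k c (falling-range k c above))
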